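{- Let $n>2$ and $k\ge 2n-1$ be integers. Suppose $A$ is a set of $k$ integers satisfying $$|S_n(A)|=(k-1)n-3\binom{n}{2}+1.$$ Then $A$ contains at least $n-1$ negative integers and also at least $n-1$ positive integers.
   Context: For a finite set $A\subseteq\mathbb{Z}$ and a positive integer $n$, define $$S_n(A)=\{a_1+\cdots+a_n:\ a_1,\ldots,a_n\in A,\ \text{and}\ a_i^2\neq a_j^2\ \text{for}\ 1\le i<j\le n\}.$$ -}

module Defs where

open import Data.Nat using (ℕ)
open import Data.Fin using (Fin)
open import Data.Integer using (ℤ; _*_)
open import Data.List using (List)
open import Data.List.Membership.Propositional using (_∈_)
open import Data.Vec.Functional using (Vector)
import Data.Vec.Functional as VF
open import Data.Product using (∃; _×_)
open import Relation.Binary.PropositionalEquality using (_≡_; _≢_)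

sumℤ : {n : ℕ} → Vector ℤ n → ℤ
sumℤ = VF.foldr Data.Integer._+_ (Data.Integer.+ 0)

InS : (n : ℕ) → (A : List ℤ) → ℤ → Set
InS n A x = ∃ λ (a : Fin n → ℤ) →
  ((i : Fin n) → a i ∈ A) ×
  ((i j : Fin n) → i ≢ j → a i * a i ≢ a j * a j) ×
  sumℤ a ≡ x

-- Write A = N ∪ P with N < 0 ≤ P. By induction on n, |S_n(A)| ≥ n |A| + 1 + (s+1 choose 2) − n s − n²
-- whenever |P| ≥ n and s ≤ n bounds the number of pairs ± z in A. Remove the largest β ∈ P and take
-- the least sum μ of the smaller instance, realised by a tuple T. The old sums shifted by β are
-- ≥ μ + β, while μ + w for the w with ± w ∉ T are new sums < μ + β. If also − β ∈ A, then μ − β is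
-- a further sum, and so are the sums where an entry − y of T (with y ∈ A, y ∉ T) is exchanged for
-- the least such w, or for y itself when there is no such w. For s = |N| ≤ n − 2 the bound exceeds
-- (k − 1) n − 3 (n choose 2) + 1; negating A handles the positives.
module Submission where

open import Defs
open import Data.Nat using (ℕ; _≤_; _>_; _∸_; _+_; _*_)
open import Data.Nat.Combinatorics using (_C_)
open import Data.Integer using (ℤ; _<_; _<?_; +_)
open import Data.List using (List; length; filter)
open import Data.List.Relation.Unary.Unique.Propositional using (Unique)
open import Data.List.Membership.Propositional using (_∈_)
open import Function.Bundles using (_⇔_)
open import Data.Product using (_×_)
open import Relation.Binary.PropositionalEquality using (_≡_)

open import Data.Empty using (⊥-elim)
open import Data.Fin using (Fin; zero; suc) renaming (_≟_ to _≟ᶠ_)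
open import Data.Integer using (-_; -[1+_]; ∣_∣; +≤+; -<+)
  renaming (_+_ to _+ᶻ_; _*_ to _*ᶻ_; _-_ to _-ᶻ_; _≤_ to _≤ᶻ_; _≟_ to _≟ᶻ_)
import Data.Integer.Properties as ℤP
open import Data.Integer.Tactic.RingSolver using (solve-∀)
open import Algebra.Properties.AbelianGroup ℤP.+-0-abelianGroup using (∙-cancelˡ; ∙-cancelʳ)
open import Data.List using ([]; _∷_; _++_; map; tabulate)
open import Data.List.Properties using (length-map; length-++; length-tabulate; filter-notAll)
open import Data.List.Membership.Propositional using (_∉_)
open import Data.List.Membership.Propositional.Properties
  using (∈-filter⁺; ∈-filter⁻; ∈-map⁺; ∈-map⁻; ∈-++⁺ˡ; ∈-++⁺ʳ; ∈-++⁻; ∈-tabulate⁺; ∈-tabulate⁻)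
open import Data.List.Membership.DecPropositional _≟ᶻ_ using (_∈?_)
open import Data.List.Relation.Binary.Disjoint.Propositional using (Disjoint)
open import Data.List.Relation.Binary.Subset.Propositional using (_⊆_)
import Data.List.Relation.Binary.Subset.Propositional.Properties as ⊆
open import Data.List.Relation.Unary.All as All using (All; []; _∷_)
import Data.List.Relation.Unary.All.Properties as AllP
open import Data.List.Relation.Unary.AllPairs using ([]; _∷_)
open import Data.List.Relation.Unary.Any using (here; there)
import Data.List.Relation.Unary.Any as Any
import Data.List.Relation.Unary.Unique.Propositional.Properties as Unique
open import Data.Nat using (zero; suc; pred; z≤n; s≤s; ≢-nonZero) renaming (_<_ to _<ℕ_)
import Data.Nat.Properties as ℕP
open import Data.Nat.Combinatorics using (nC1≡n; nCk+nC[k+1]≡[n+1]C[k+1])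
open import Data.Nat.Solver using (module +-*-Solver)
open import Data.Product using (∃; _,_; proj₁; proj₂)
open import Data.Sum using (_⊎_; inj₁; inj₂; [_,_])
import Data.Vec.Functional as Vec
open import Data.Vec.Functional using (Vector; updateAt)
open import Data.Vec.Functional.Properties using (updateAt-updates; updateAt-minimal)
open import Function using (_∘_; const; id)
open import Function.Bundles using (Equivalence)
open import Relation.Binary.Definitions using (DecidableEquality; tri<; tri≈; tri>)
open import Relation.Binary.PropositionalEquality
  using (refl; sym; trans; cong; cong₂; subst; subst₂; _≢_; module ≡-Reasoning)
open import Relation.Nullary using (Dec; yes; no; ¬?)

Apart : ℤ → ℤ → Set
Apart x y = x ≢ y × x ≢ - y

neg-square : ∀ x → - x *ᶻ - x ≡ x *ᶻ x
neg-square = solve-∀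

m*m≡n*n⇒m≡n : ∀ m n → m * m ≡ n * n → m ≡ n
m*m≡n*n⇒m≡n m n eq with ℕP.<-cmp m n
... | tri≈ _ m≡n _ = m≡n
... | tri< m<n _ _ = ⊥-elim (ℕP.<-irrefl eq (ℕP.*-mono-< m<n m<n))
... | tri> _ _ m>n = ⊥-elim (ℕP.<-irrefl (sym eq) (ℕP.*-mono-< m>n m>n))

∣i∣≡∣j∣⇒i≡±j : ∀ i j → ∣ i ∣ ≡ ∣ j ∣ → i ≡ j ⊎ i ≡ - j
∣i∣≡∣j∣⇒i≡±j (+ m)       (+ n)       eq = inj₁ (cong +_ eq)
∣i∣≡∣j∣⇒i≡±j (+ zero)    -[1+ n ]    ()
∣i∣≡∣j∣⇒i≡±j (+ suc m)   -[1+ n ]    eq = inj₂ (cong +_ eq)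
∣i∣≡∣j∣⇒i≡±j -[1+ m ]    (+ zero)    ()
∣i∣≡∣j∣⇒i≡±j -[1+ m ]    (+ suc n)   eq = inj₂ (cong -[1+_] (ℕP.suc-injective eq))
∣i∣≡∣j∣⇒i≡±j -[1+ m ]    -[1+ n ]    eq = inj₁ (cong -[1+_] (ℕP.suc-injective eq))

i*i≡j*j⇒i≡±j : ∀ i j → i *ᶻ i ≡ j *ᶻ j → i ≡ j ⊎ i ≡ - j
i*i≡j*j⇒i≡±j i j eq = ∣i∣≡∣j∣⇒i≡±j i j (m*m≡n*n⇒m≡n ∣ i ∣ ∣ j ∣ (begin
  ∣ i ∣ * ∣ i ∣  ≡⟨ ℤP.∣i*j∣≡∣i∣*∣j∣ i i ⟨
  ∣ i *ᶻ i ∣     ≡⟨ cong ∣_∣ eq ⟩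
  ∣ j *ᶻ j ∣     ≡⟨ ℤP.∣i*j∣≡∣i∣*∣j∣ j j ⟩
  ∣ j ∣ * ∣ j ∣  ∎))
  where open ≡-Reasoning

apart⇒squares≢ : ∀ {x y} → Apart x y → x *ᶻ x ≢ y *ᶻ y
apart⇒squares≢ {x} {y} (x≢y , x≢-y) eq with i*i≡j*j⇒i≡±j x y eq
... | inj₁ x≡y = x≢y x≡y
... | inj₂ x≡-y = x≢-y x≡-y

apart-sym : ∀ {x y} → Apart x y → Apart y x
apart-sym {x} {y} (x≢y , x≢-y) =
  (λ y≡x → x≢y (sym y≡x)) ,
  (λ y≡-x → x≢-y (trans (sym (ℤP.neg-involutive x)) (cong -_ (sym y≡-x))))

Admissible : (n : ℕ) → List ℤ → Vector ℤ n → Set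
Admissible n A a = ((i : Fin n) → a i ∈ A) × ((i j : Fin n) → i ≢ j → a i *ᶻ a i ≢ a j *ᶻ a j)

admissible⇒InS : ∀ {n A a} → Admissible n A a → InS n A (sumℤ a)
admissible⇒InS (mem , dist) = _ , mem , dist , refl

admissible-⊆ : ∀ {n A B a} → A ⊆ B → Admissible n A a → Admissible n B a
admissible-⊆ A⊆B (mem , dist) = A⊆B ∘ mem , dist

InS-⊆ : ∀ {n A B x} → A ⊆ B → InS n A x → InS n B x
InS-⊆ A⊆B (a , mem , dist , sum) = a , A⊆B ∘ mem , dist , sum

admissible-injective : ∀ {n A a} → Admissible n A a → ∀ {i j} → a i ≡ a j → i ≡ j
admissible-injective (_ , dist) {i} {j} eq with i ≟ᶠ j
... | yes i≡j = i≡j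
... | no i≢j = ⊥-elim (dist i j i≢j (cong (λ z → z *ᶻ z) eq))

∷-admissible : ∀ {n A a x} → Admissible n A a → x ∈ A → (∀ i → Apart (a i) x) →
               Admissible (suc n) A (x Vec.∷ a)
∷-admissible {n} {A} {a} {x} (mem , dist) x∈A a-apart-x = mem′ , dist′
  where
  mem′ : ∀ i → (x Vec.∷ a) i ∈ A
  mem′ zero = x∈A
  mem′ (suc i) = mem i
  dist′ : ∀ i j → i ≢ j → (x Vec.∷ a) i *ᶻ (x Vec.∷ a) i ≢ (x Vec.∷ a) j *ᶻ (x Vec.∷ a) j
  dist′ zero zero 0≢0 = ⊥-elim (0≢0 refl)
  dist′ zero (suc j) _ = apart⇒squares≢ (apart-sym (a-apart-x j))
  dist′ (suc i) zero _ = apart⇒squares≢ (a-apart-x i)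
  dist′ (suc i) (suc j) i≢j = dist i j (i≢j ∘ cong suc)

updateAt-admissible : ∀ {n A a x} i → Admissible n A a → x ∈ A → (∀ j → j ≢ i → Apart (a j) x) →
                      Admissible n A (updateAt a i (const x))
updateAt-admissible {n} {A} {a} {x} i (mem , dist) x∈A a-apart-x = mem′ , dist′
  where
  a′ : Vector ℤ n
  a′ = updateAt a i (const x)
  a′-at-i : a′ i ≡ x
  a′-at-i = updateAt-updates i a
  a′-elsewhere : ∀ j → j ≢ i → a′ j ≡ a j
  a′-elsewhere j j≢i = updateAt-minimal j i a j≢i
  mem′ : ∀ j → a′ j ∈ A
  mem′ j with j ≟ᶠ i
  ... | yes refl = subst (_∈ A) (sym a′-at-i) x∈A
  ... | no j≢i = subst (_∈ A) (sym (a′-elsewhere j j≢i)) (mem j)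
  dist′ : ∀ j k → j ≢ k → a′ j *ᶻ a′ j ≢ a′ k *ᶻ a′ k
  dist′ j k j≢k with j ≟ᶠ i | k ≟ᶠ i
  ... | yes refl | yes refl = ⊥-elim (j≢k refl)
  ... | yes refl | no k≢i rewrite a′-at-i | a′-elsewhere k k≢i =
    apart⇒squares≢ (apart-sym (a-apart-x k k≢i))
  ... | no j≢i | yes refl rewrite a′-at-i | a′-elsewhere j j≢i =
    apart⇒squares≢ (a-apart-x j j≢i)
  ... | no j≢i | no k≢i rewrite a′-elsewhere j j≢i | a′-elsewhere k k≢i = dist j k j≢k

sumℤ-updateAt : ∀ {n} (a : Vector ℤ n) i x → sumℤ (updateAt a i (const x)) +ᶻ a i ≡ sumℤ a +ᶻ x
sumℤ-updateAt a zero x = exchange x (a zero) (sumℤ (Vec.tail a))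
  where
  exchange : ∀ x y s → (x +ᶻ s) +ᶻ y ≡ (y +ᶻ s) +ᶻ x
  exchange = solve-∀
sumℤ-updateAt a (suc i) x = begin
  (a zero +ᶻ sumℤ a′) +ᶻ a (suc i)   ≡⟨ ℤP.+-assoc (a zero) _ _ ⟩
  a zero +ᶻ (sumℤ a′ +ᶻ a (suc i))   ≡⟨ cong (a zero +ᶻ_) (sumℤ-updateAt (Vec.tail a) i x) ⟩
  a zero +ᶻ (sumℤ (Vec.tail a) +ᶻ x) ≡⟨ ℤP.+-assoc (a zero) _ _ ⟨
  (a zero +ᶻ sumℤ (Vec.tail a)) +ᶻ x ∎
  where
  open ≡-Reasoning
  a′ : Vector ℤ _
  a′ = updateAt (Vec.tail a) i (const x)

module _ {A : Set} where

  length-filter-split : {P : A → Set} (P? : ∀ x → Dec (P x)) (xs : List A) →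
    length (filter P? xs) + length (filter (¬? ∘ P?) xs) ≡ length xs
  length-filter-split P? [] = refl
  length-filter-split P? (x ∷ xs) with P? x
  ... | yes _ = cong suc (length-filter-split P? xs)
  ... | no _ = trans (ℕP.+-suc _ _) (cong suc (length-filter-split P? xs))

  Unique-map⁺ : ∀ {B : Set} {xs} (f : A → B) → (∀ {x y} → x ∈ xs → y ∈ xs → f x ≡ f y → x ≡ y) →
                Unique xs → Unique (map f xs)
  Unique-map⁺ {xs = []} f _ [] = []
  Unique-map⁺ {xs = x ∷ xs} f inj (x∉xs ∷ unique-xs) =
    All.tabulate fx≢ ∷ Unique-map⁺ f (λ x∈ y∈ → inj (there x∈) (there y∈)) unique-xs
    where
    fx≢ : ∀ {z} → z ∈ map f xs → f x ≢ z
    fx≢ z∈ fx≡z with ∈-map⁻ f z∈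
    ... | y , y∈xs , refl = All.lookup x∉xs y∈xs (inj (here refl) (there y∈xs) fx≡z)

module WithDecidableEquality {A : Set} (_≟_ : DecidableEquality A) where

  remove : A → List A → List A
  remove x = filter (λ z → ¬? (z ≟ x))

  ∈-remove⁺ : ∀ {x z ys} → z ∈ ys → z ≢ x → z ∈ remove x ys
  ∈-remove⁺ {x} z∈ys z≢x = ∈-filter⁺ (λ z → ¬? (z ≟ x)) z∈ys z≢x

  ∈-remove⁻ : ∀ {x z ys} → z ∈ remove x ys → z ∈ ys × z ≢ x
  ∈-remove⁻ {x} {ys = ys} = ∈-filter⁻ (λ z → ¬? (z ≟ x)) {xs = ys}

  length-remove< : ∀ {x ys} → x ∈ ys → suc (length (remove x ys)) ≤ length ys
  length-remove< {x} {ys} x∈ys =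
    filter-notAll (λ z → ¬? (z ≟ x)) ys (Any.map (λ x≡z z≢x → z≢x (sym x≡z)) x∈ys)

  Unique-⊆⇒length≤ : ∀ {xs ys} → Unique xs → xs ⊆ ys → length xs ≤ length ys
  Unique-⊆⇒length≤ {[]} _ _ = z≤n
  Unique-⊆⇒length≤ {x ∷ xs} {ys} (x∉xs ∷ unique-xs) x∷xs⊆ys =
    ℕP.≤-trans (s≤s (Unique-⊆⇒length≤ unique-xs xs⊆ys-x)) (length-remove< (x∷xs⊆ys (here refl)))
    where
    xs⊆ys-x : xs ⊆ remove x ys
    xs⊆ys-x z∈ = ∈-remove⁺ (x∷xs⊆ys (there z∈)) (λ z≡x → All.lookup x∉xs z∈ (sym z≡x))

  length-remove : ∀ {x ys} → Unique ys → x ∈ ys → suc (length (remove x ys)) ≡ length ys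
  length-remove {x} {ys} unique-ys x∈ys =
    ℕP.≤-antisym (length-remove< x∈ys) (Unique-⊆⇒length≤ unique-ys ys⊆x∷ys-x)
    where
    ys⊆x∷ys-x : ys ⊆ x ∷ remove x ys
    ys⊆x∷ys-x {z} z∈ys with z ≟ x
    ... | yes z≡x = here z≡x
    ... | no z≢x = there (∈-remove⁺ z∈ys z≢x)

  injection⇒length≤ : ∀ {B : Set} {xs : List B} {ys} (f : B → A) → Unique xs →
    (∀ {x y} → x ∈ xs → y ∈ xs → f x ≡ f y → x ≡ y) → (∀ {x} → x ∈ xs → f x ∈ ys) →
    length xs ≤ length ys
  injection⇒length≤ {xs = xs} {ys} f unique-xs f-injective f∈ys =
    subst (_≤ length ys) (length-map f xs) (Unique-⊆⇒length≤ (Unique-map⁺ f f-injective unique-xs) image⊆ys)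
    where
    image⊆ys : map f xs ⊆ ys
    image⊆ys z∈ with ∈-map⁻ f z∈
    ... | x , x∈xs , refl = f∈ys x∈xs

open WithDecidableEquality _≟ᶻ_

least : (xs : List ℤ) → 1 ≤ length xs → ∃ λ m → m ∈ xs × All (m ≤ᶻ_) xs
least (x ∷ []) _ = x , here refl , ℤP.≤-refl ∷ []
least (x ∷ y ∷ ys) _ with least (y ∷ ys) (s≤s z≤n)
... | m , m∈ , m≤ with ℤP.≤-total m x
...   | inj₁ m≤x = m , there m∈ , m≤x ∷ m≤
...   | inj₂ x≤m = x , here refl , ℤP.≤-refl ∷ All.map (ℤP.≤-trans x≤m) m≤

greatest : (xs : List ℤ) → 1 ≤ length xs → ∃ λ m → m ∈ xs × All (_≤ᶻ m) xs
greatest (x ∷ []) _ = x , here refl , ℤP.≤-refl ∷ []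
greatest (x ∷ y ∷ ys) _ with greatest (y ∷ ys) (s≤s z≤n)
... | m , m∈ , ≤m with ℤP.≤-total x m
...   | inj₁ x≤m = m , there m∈ , x≤m ∷ ≤m
...   | inj₂ m≤x = x , here refl , ℤP.≤-refl ∷ All.map (λ z≤m → ℤP.≤-trans z≤m m≤x) ≤m

separated⇒disjoint : ∀ {xs ys : List ℤ} c → (∀ {x} → x ∈ xs → x < c) → (∀ {y} → y ∈ ys → c ≤ᶻ y) →
                     Disjoint xs ys
separated⇒disjoint c xs<c c≤ys (x∈xs , x∈ys) = ℤP.<⇒≱ (xs<c x∈xs) (c≤ys x∈ys)

module Complement {n : ℕ} {A : List ℤ} (unique-A : Unique A) {T : Vector ℤ n}
                  (T-admissible : Admissible n A T) where

  Used : List ℤ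
  Used = tabulate T

  Unused : List ℤ
  Unused = filter (λ w → ¬? (w ∈? Used)) A

  Free : List ℤ
  Free = filter (λ w → ¬? (- w ∈? Used)) Unused

  Mirrored : List ℤ
  Mirrored = filter (λ w → - w ∈? Used) Unused

  unique-Used : Unique Used
  unique-Used = Unique.tabulate⁺ (admissible-injective T-admissible)

  Used⊆A : Used ⊆ A
  Used⊆A z∈ with ∈-tabulate⁻ z∈
  ... | i , refl = proj₁ T-admissible i

  length-Used∩A : length (filter (_∈? Used) A) ≡ n
  length-Used∩A = trans (ℕP.≤-antisym
    (Unique-⊆⇒length≤ (Unique.filter⁺ _ unique-A) (proj₂ ∘ ∈-filter⁻ (_∈? Used) {xs = A}))
    (Unique-⊆⇒length≤ unique-Used (λ z∈ → ∈-filter⁺ (_∈? Used) (Used⊆A z∈) z∈)))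
    (length-tabulate T)

  length-Complement : length Mirrored + length Free + n ≡ length A
  length-Complement = begin
    length Mirrored + length Free + n ≡⟨ cong (_+ n) (length-filter-split (λ w → - w ∈? Used) Unused) ⟩
    length Unused + n                 ≡⟨ ℕP.+-comm (length Unused) n ⟩
    n + length Unused                 ≡⟨ cong (_+ length Unused) length-Used∩A ⟨
    length (filter (_∈? Used) A) + length Unused ≡⟨ length-filter-split (_∈? Used) A ⟩
    length A                          ∎
    where open ≡-Reasoning

  ∈-Unused⁻ : ∀ {w} → w ∈ Unused → w ∈ A × w ∉ Used
  ∈-Unused⁻ = ∈-filter⁻ (λ w → ¬? (w ∈? Used)) {xs = A}

  ∈-Free⁻ : ∀ {w} → w ∈ Free → w ∈ A × w ∉ Used × - w ∉ Used
  ∈-Free⁻ w∈ with ∈-filter⁻ (λ w → ¬? (- w ∈? Used)) {xs = Unused} w∈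
  ... | w∈Unused , -w∉Used = proj₁ (∈-Unused⁻ w∈Unused) , proj₂ (∈-Unused⁻ w∈Unused) , -w∉Used

  ∈-Mirrored⁻ : ∀ {w} → w ∈ Mirrored → w ∈ A × w ∉ Used × - w ∈ Used
  ∈-Mirrored⁻ w∈ with ∈-filter⁻ (λ w → - w ∈? Used) {xs = Unused} w∈
  ... | w∈Unused , -w∈Used = proj₁ (∈-Unused⁻ w∈Unused) , proj₂ (∈-Unused⁻ w∈Unused) , -w∈Used

  unique-Free : Unique Free
  unique-Free = Unique.filter⁺ _ (Unique.filter⁺ _ unique-A)

  unique-Mirrored : Unique Mirrored
  unique-Mirrored = Unique.filter⁺ _ (Unique.filter⁺ _ unique-A)

  Free-apart : ∀ {w} → w ∈ Free → ∀ i → Apart (T i) w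
  Free-apart w∈ i =
    (λ Ti≡w → proj₁ (proj₂ (∈-Free⁻ w∈)) (subst (_∈ Used) Ti≡w (∈-tabulate⁺ i))) ,
    (λ Ti≡-w → proj₂ (proj₂ (∈-Free⁻ w∈)) (subst (_∈ Used) Ti≡-w (∈-tabulate⁺ i)))

  mirror-index : ∀ {y} → y ∈ Mirrored → ∃ λ i → T i ≡ - y
  mirror-index y∈ with ∈-tabulate⁻ (proj₂ (proj₂ (∈-Mirrored⁻ y∈)))
  ... | i , -y≡Ti = i , sym -y≡Ti

  length-Mirrored≤n : length Mirrored ≤ n
  length-Mirrored≤n = subst (length Mirrored ≤_) (length-tabulate T)
    (injection⇒length≤ -_ unique-Mirrored (λ _ _ → ℤP.neg-injective) (proj₂ ∘ proj₂ ∘ ∈-Mirrored⁻))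

triangle : ℕ → ℕ
triangle zero = zero
triangle (suc s) = suc s + triangle s

-- In the step bounds the triangular numbers are abstracted to t and t′, so that the
-- remaining identities are polynomial.
unpaired-bound : ∀ {n p m s s′ t t′ L V K} →
  K + t + n * s′ ≤ t′ + suc n * s → V + K + n ≡ m + p →
  n * p + n * m + 1 + t′ ≤ L + n * s′ + n * n →
  suc n * suc p + suc n * m + 1 + t ≤ (V + L) + suc n * s + suc n * suc n
unpaired-bound {n} {p} {m} {s} {s′} {t} {t′} {L} {V} {K} side split ih =
  ℕP.+-cancelʳ-≤ (t′ + n * s′) _ _ (begin
    suc n * suc p + suc n * m + 1 + t + (t′ + n * s′)
      ≡⟨ regroupˡ n p m s′ t t′ ⟩
    (n * p + n * m + 1 + t′) + ((m + p) + n + 1 + (t + n * s′))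
      ≡⟨ cong (λ z → (n * p + n * m + 1 + t′) + (z + n + 1 + (t + n * s′))) split ⟨
    (n * p + n * m + 1 + t′) + ((V + K + n) + n + 1 + (t + n * s′))
      ≡⟨ cong (λ z → (n * p + n * m + 1 + t′) + z) (regroupᵐ n s′ t V K) ⟩
    (n * p + n * m + 1 + t′) + ((V + n + n + 1) + (K + t + n * s′))
      ≤⟨ ℕP.+-mono-≤ ih (ℕP.+-monoʳ-≤ (V + n + n + 1) side) ⟩
    (L + n * s′ + n * n) + ((V + n + n + 1) + (t′ + suc n * s))
      ≡⟨ regroupʳ n s s′ t′ L V ⟩
    (V + L) + suc n * s + suc n * suc n + (t′ + n * s′) ∎)
  where
  open ℕP.≤-Reasoning
  open +-*-Solver
  regroupˡ : ∀ n p m s′ t t′ → suc n * suc p + suc n * m + 1 + t + (t′ + n * s′) ≡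
             (n * p + n * m + 1 + t′) + ((m + p) + n + 1 + (t + n * s′))
  regroupˡ = solve 6 (λ n p m s′ t t′ →
    (con 1 :+ n) :* (con 1 :+ p) :+ (con 1 :+ n) :* m :+ con 1 :+ t :+ (t′ :+ n :* s′) :=
    (n :* p :+ n :* m :+ con 1 :+ t′) :+ ((m :+ p) :+ n :+ con 1 :+ (t :+ n :* s′))) refl
  regroupᵐ : ∀ n s′ t V K → (V + K + n) + n + 1 + (t + n * s′) ≡ (V + n + n + 1) + (K + t + n * s′)
  regroupᵐ = solve 5 (λ n s′ t V K →
    (V :+ K :+ n) :+ n :+ con 1 :+ (t :+ n :* s′) := (V :+ n :+ n :+ con 1) :+ (K :+ t :+ n :* s′)) refl
  regroupʳ : ∀ n s s′ t′ L V → (L + n * s′ + n * n) + ((V + n + n + 1) + (t′ + suc n * s)) ≡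
             (V + L) + suc n * s + suc n * suc n + (t′ + n * s′)
  regroupʳ = solve 6 (λ n s s′ t′ L V →
    (L :+ n :* s′ :+ n :* n) :+ ((V :+ n :+ n :+ con 1) :+ (t′ :+ (con 1 :+ n) :* s)) :=
    (V :+ L) :+ (con 1 :+ n) :* s :+ (con 1 :+ n) :* (con 1 :+ n) :+ (t′ :+ n :* s′)) refl

unsaturated-side : ∀ {n s t K} → K ≤ s → K + t + n * s ≤ t + suc n * s
unsaturated-side {n} {s} {t} {K} K≤s = begin
  K + t + n * s ≤⟨ ℕP.+-monoˡ-≤ (n * s) (ℕP.+-monoˡ-≤ t K≤s) ⟩
  s + t + n * s ≡⟨ regroup n s t ⟩
  t + suc n * s ∎
  where
  open ℕP.≤-Reasoning
  open +-*-Solver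
  regroup : ∀ n s t → s + t + n * s ≡ t + suc n * s
  regroup = solve 3 (λ n s t → s :+ t :+ n :* s := t :+ (con 1 :+ n) :* s) refl

saturated-side : ∀ {n t K} → K ≤ n → K + (suc n + t) + n * n ≤ t + suc n * suc n
saturated-side {n} {t} {K} K≤n = begin
  K + (suc n + t) + n * n ≤⟨ ℕP.+-monoˡ-≤ (n * n) (ℕP.+-monoˡ-≤ (suc n + t) K≤n) ⟩
  n + (suc n + t) + n * n ≡⟨ regroup n t ⟩
  t + suc n * suc n       ∎
  where
  open ℕP.≤-Reasoning
  open +-*-Solver
  regroup : ∀ n t → n + (suc n + t) + n * n ≡ t + suc n * suc n
  regroup = solve 2 (λ n t → n :+ ((con 1 :+ n) :+ t) :+ n :* n := t :+ (con 1 :+ n) :* (con 1 :+ n)) refl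

paired-bound : ∀ {n p m s t L X} → X + n ≡ m + p →
  n * p + n * m + 1 + t ≤ L + n * s + n * n →
  suc n * suc p + suc n * suc m + 1 + (suc s + t) ≤ (X + suc L) + suc n * suc s + suc n * suc n
paired-bound {n} {p} {m} {s} {t} {L} {X} split ih = begin
  suc n * suc p + suc n * suc m + 1 + (suc s + t)
    ≡⟨ regroupˡ n p m s t ⟩
  (n * p + n * m + 1 + t) + ((m + p) + n + n + s + 3)
    ≡⟨ cong (λ z → (n * p + n * m + 1 + t) + (z + n + n + s + 3)) split ⟨
  (n * p + n * m + 1 + t) + ((X + n) + n + n + s + 3)
    ≤⟨ ℕP.+-monoˡ-≤ _ ih ⟩
  (L + n * s + n * n) + ((X + n) + n + n + s + 3)
    ≡⟨ regroupʳ n s L X ⟩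
  (X + suc L) + suc n * suc s + suc n * suc n ∎
  where
  open ℕP.≤-Reasoning
  open +-*-Solver
  regroupˡ : ∀ n p m s t → suc n * suc p + suc n * suc m + 1 + (suc s + t) ≡
             (n * p + n * m + 1 + t) + ((m + p) + n + n + s + 3)
  regroupˡ = solve 5 (λ n p m s t →
    (con 1 :+ n) :* (con 1 :+ p) :+ (con 1 :+ n) :* (con 1 :+ m) :+ con 1 :+ (con 1 :+ s :+ t) :=
    (n :* p :+ n :* m :+ con 1 :+ t) :+ ((m :+ p) :+ n :+ n :+ s :+ con 3)) refl
  regroupʳ : ∀ n s L X → (L + n * s + n * n) + ((X + n) + n + n + s + 3) ≡
             (X + suc L) + suc n * suc s + suc n * suc n
  regroupʳ = solve 4 (λ n s L X →
    (L :+ n :* s :+ n :* n) :+ ((X :+ n) :+ n :+ n :+ s :+ con 3) :=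
    (X :+ (con 1 :+ L)) :+ (con 1 :+ n) :* (con 1 :+ s) :+ (con 1 :+ n) :* (con 1 :+ n)) refl

PairedAtMost : ℕ → List ℤ → List ℤ → Set
PairedAtMost s N P = ∃ λ Q → length Q ≤ s × (∀ {z} → z ∈ N → - z ∈ P → z ∈ Q)

record Config (n : ℕ) (N P : List ℤ) (s : ℕ) : Set where
  field
    unique-N : Unique N
    N<0 : All (_< + 0) N
    unique-P : Unique P
    0≤P : All (+ 0 ≤ᶻ_) P
    n≤|P| : n ≤ length P
    cap≤n : s ≤ n
    few-pairs : s ≡ n ⊎ PairedAtMost s N P

-- |S_n(A)| ≥ n p + n m + 1 + (s+1 choose 2) − n s − n², witnessed by a list of distinct sums.
record ManySums (n : ℕ) (A : List ℤ) (p m s : ℕ) : Set where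
  constructor manySums
  field
    sums : List ℤ
    unique : Unique sums
    sound : All (InS n A) sums
    nonempty : 1 ≤ length sums
    large : n * p + n * m + 1 + triangle s ≤ length sums + n * s + n * n

base : ∀ {N P s} → Config 0 N P s → ManySums 0 (N ++ P) (length P) (length N) s
base {s = zero} _ =
  manySums (+ 0 ∷ []) ([] ∷ []) (((λ ()) , (λ ()) , (λ ()) , refl) ∷ []) (s≤s z≤n) (s≤s z≤n)
base {s = suc _} c with Config.cap≤n c
... | ()

negAbs : ℤ → ℤ
negAbs x = - (+ ∣ x ∣)

i+i≡j+j⇒i≡j : ∀ i j → i +ᶻ i ≡ j +ᶻ j → i ≡ j
i+i≡j+j⇒i≡j i j eq with ℤP.<-cmp i j
... | tri≈ _ i≡j _ = i≡j
... | tri< i<j _ _ = ⊥-elim (ℤP.<-irrefl eq (ℤP.+-mono-< i<j i<j))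
... | tri> _ _ i>j = ⊥-elim (ℤP.<-irrefl (sym eq) (ℤP.+-mono-< i>j i>j))

y<b⇒c+[y-b]<c : ∀ c {y b} → y < b → c +ᶻ (y -ᶻ b) < c
y<b⇒c+[y-b]<c c {y} {b} y<b = subst₂ _<_ (regroupˡ c y b) (regroupʳ c b) (ℤP.+-monoʳ-< (c -ᶻ b) y<b)
  where
  regroupˡ : ∀ c y b → (c -ᶻ b) +ᶻ y ≡ c +ᶻ (y -ᶻ b)
  regroupˡ = solve-∀
  regroupʳ : ∀ c b → (c -ᶻ b) +ᶻ b ≡ c
  regroupʳ = solve-∀

[μ+w]+[y-b]≡-b+μ⇒w≡-y : ∀ μ w y b → (μ +ᶻ w) +ᶻ (y -ᶻ b) ≡ - b +ᶻ μ → w ≡ - y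
[μ+w]+[y-b]≡-b+μ⇒w≡-y μ w y b eq = begin
  w                                           ≡⟨ regroupˡ μ w y b ⟩
  ((μ +ᶻ w) +ᶻ (y -ᶻ b)) +ᶻ ((b -ᶻ μ) -ᶻ y)   ≡⟨ cong (_+ᶻ ((b -ᶻ μ) -ᶻ y)) eq ⟩
  (- b +ᶻ μ) +ᶻ ((b -ᶻ μ) -ᶻ y)               ≡⟨ regroupʳ μ y b ⟩
  - y                                         ∎
  where
  open ≡-Reasoning
  regroupˡ : ∀ μ w y b → w ≡ ((μ +ᶻ w) +ᶻ (y -ᶻ b)) +ᶻ ((b -ᶻ μ) -ᶻ y)
  regroupˡ = solve-∀
  regroupʳ : ∀ μ y b → (- b +ᶻ μ) +ᶻ ((b -ᶻ μ) -ᶻ y) ≡ - y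
  regroupʳ = solve-∀

module Step {n : ℕ} {N P : List ℤ} {s : ℕ} (c : Config (suc n) N P s) where
  open Config c

  Induction-hypothesis : Set
  Induction-hypothesis =
    ∀ {N′ P′ s′} → Config n N′ P′ s′ → ManySums n (N′ ++ P′) (length P′) (length N′) s′

  private
    greatest-P : ∃ λ β → β ∈ P × All (_≤ᶻ β) P
    greatest-P = greatest P (ℕP.≤-trans (s≤s z≤n) n≤|P|)

  β : ℤ
  β = proj₁ greatest-P

  β∈P : β ∈ P
  β∈P = proj₁ (proj₂ greatest-P)

  0≤β : + 0 ≤ᶻ β
  0≤β = All.lookup 0≤P β∈P

  P⁻ : List ℤ
  P⁻ = remove β P

  length-P⁻ : suc (length P⁻) ≡ length P
  length-P⁻ = length-remove unique-P β∈P

  ∈-P⁻⁻ : ∀ {z} → z ∈ P⁻ → z ∈ P × z ≢ β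
  ∈-P⁻⁻ = ∈-remove⁻ {ys = P}

  P⁻⊆P : P⁻ ⊆ P
  P⁻⊆P = proj₁ ∘ ∈-P⁻⁻

  0≤P⁻ : All (+ 0 ≤ᶻ_) P⁻
  0≤P⁻ = AllP.anti-mono P⁻⊆P 0≤P

  P⁻<β : ∀ {z} → z ∈ P⁻ → z < β
  P⁻<β z∈ = ℤP.≤∧≢⇒< (All.lookup (proj₂ (proj₂ greatest-P)) (P⁻⊆P z∈)) (proj₂ (∈-P⁻⁻ z∈))

  P⁻∌-β : ∀ {z} → z ∈ P⁻ → z ≢ - β
  P⁻∌-β {z} z∈ z≡-β = ℤP.<⇒≱ (P⁻<β z∈) (ℤP.≤-trans β≤-z -z≤z)
    where
    β≤-z : β ≤ᶻ - z
    β≤-z = ℤP.≤-reflexive (trans (sym (ℤP.neg-involutive β)) (cong -_ (sym z≡-β)))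
    -z≤z : - z ≤ᶻ z
    -z≤z = ℤP.≤-trans (ℤP.neg-mono-≤ (All.lookup 0≤P⁻ z∈)) (All.lookup 0≤P⁻ z∈)

  n≤|P⁻| : n ≤ length P⁻
  n≤|P⁻| = ℕP.≤-pred (subst (suc n ≤_) (sym length-P⁻) n≤|P|)

  module Below (N⁻ : List ℤ) (unique-N⁻ : Unique N⁻) (N⁻⊆N : N⁻ ⊆ N)
               (N⁻∌-β : ∀ {z} → z ∈ N⁻ → z ≢ - β) where

    A⁻ : List ℤ
    A⁻ = N⁻ ++ P⁻

    N⁻<0 : ∀ {z} → z ∈ N⁻ → z < + 0
    N⁻<0 = All.lookup N<0 ∘ N⁻⊆N

    unique-A⁻ : Unique A⁻
    unique-A⁻ = Unique.++⁺ unique-N⁻ (Unique.filter⁺ _ unique-P)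
      (separated⇒disjoint (+ 0) N⁻<0 (All.lookup 0≤P⁻))

    A⁻⊆A : A⁻ ⊆ N ++ P
    A⁻⊆A = ⊆.++⁺ N⁻⊆N P⁻⊆P

    A⁻<β : ∀ {z} → z ∈ A⁻ → z < β
    A⁻<β z∈ with ∈-++⁻ N⁻ z∈
    ... | inj₁ z∈N⁻ = ℤP.<-≤-trans (N⁻<0 z∈N⁻) 0≤β
    ... | inj₂ z∈P⁻ = P⁻<β z∈P⁻

    A⁻-apart-β : ∀ {z} → z ∈ A⁻ → Apart z β
    A⁻-apart-β {z} z∈ = ℤP.<⇒≢ (A⁻<β z∈) , z≢-β
      where
      z≢-β : z ≢ - β
      z≢-β with ∈-++⁻ N⁻ z∈
      ... | inj₁ z∈N⁻ = N⁻∌-β z∈N⁻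
      ... | inj₂ z∈P⁻ = P⁻∌-β z∈P⁻

    negative-∈N⁻ : ∀ {z} → z ∈ A⁻ → z < + 0 → z ∈ N⁻
    negative-∈N⁻ z∈ z<0 with ∈-++⁻ N⁻ z∈
    ... | inj₁ z∈N⁻ = z∈N⁻
    ... | inj₂ z∈P⁻ = ⊥-elim (ℤP.<⇒≱ z<0 (All.lookup 0≤P⁻ z∈P⁻))

    nonnegative-∈P⁻ : ∀ {z} → z ∈ A⁻ → + 0 ≤ᶻ z → z ∈ P⁻
    nonnegative-∈P⁻ z∈ 0≤z with ∈-++⁻ N⁻ z∈
    ... | inj₁ z∈N⁻ = ⊥-elim (ℤP.<⇒≱ (N⁻<0 z∈N⁻) 0≤z)
    ... | inj₂ z∈P⁻ = z∈P⁻

    β-extend : ∀ {x} → InS n A⁻ x → InS (suc n) (N ++ P) (β +ᶻ x)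
    β-extend (a , mem , dist , refl) = admissible⇒InS
      (∷-admissible (admissible-⊆ A⁻⊆A (mem , dist)) (∈-++⁺ʳ N β∈P) (λ i → A⁻-apart-β (mem i)))

    module Extend {s′ : ℕ} (ih : ManySums n A⁻ (length P⁻) (length N⁻) s′) where
      open ManySums ih

      private
        least-sum : ∃ λ μ → μ ∈ sums × All (μ ≤ᶻ_) sums
        least-sum = least sums nonempty

        μ-realised : InS n A⁻ (proj₁ least-sum)
        μ-realised = All.lookup sound (proj₁ (proj₂ least-sum))

      μ : ℤ
      μ = proj₁ least-sum

      T : Vector ℤ n
      T = proj₁ μ-realised

      T-admissible : Admissible n A⁻ T
      T-admissible = proj₁ (proj₂ μ-realised) , proj₁ (proj₂ (proj₂ μ-realised))

      ΣT≡μ : sumℤ T ≡ μ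
      ΣT≡μ = proj₂ (proj₂ (proj₂ μ-realised))

      open Complement unique-A⁻ T-admissible public

      T-admissible⁺ : Admissible n (N ++ P) T
      T-admissible⁺ = admissible-⊆ A⁻⊆A T-admissible

      shifted : List ℤ
      shifted = map (β +ᶻ_) sums

      μ+β≤shifted : ∀ {v} → v ∈ shifted → μ +ᶻ β ≤ᶻ v
      μ+β≤shifted v∈ with ∈-map⁻ (β +ᶻ_) v∈
      ... | l , l∈ , refl =
        subst (_≤ᶻ β +ᶻ l) (ℤP.+-comm β μ) (ℤP.+-monoʳ-≤ β (All.lookup (proj₂ (proj₂ least-sum)) l∈))

      unique-shifted : Unique shifted
      unique-shifted = Unique.map⁺ (λ {x} {y} → ∙-cancelˡ β x y) unique

      sound-shifted : All (InS (suc n) (N ++ P)) shifted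
      sound-shifted = AllP.map⁺ (All.map β-extend sound)

      free : List ℤ
      free = map (μ +ᶻ_) Free

      free<μ+β : ∀ {v} → v ∈ free → v < μ +ᶻ β
      free<μ+β v∈ with ∈-map⁻ (μ +ᶻ_) v∈
      ... | w , w∈ , refl = ℤP.+-monoʳ-< μ (A⁻<β (proj₁ (∈-Free⁻ w∈)))

      unique-free : Unique free
      unique-free = Unique.map⁺ (λ {x} {y} → ∙-cancelˡ μ x y) unique-Free

      sound-free : All (InS (suc n) (N ++ P)) free
      sound-free = AllP.map⁺ (All.tabulate λ {w} w∈ →
        subst (InS (suc n) (N ++ P)) (trans (cong (w +ᶻ_) ΣT≡μ) (ℤP.+-comm w μ))
          (admissible⇒InS (∷-admissible T-admissible⁺ (A⁻⊆A (proj₁ (∈-Free⁻ w∈))) (Free-apart w∈))))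

      length-A⁻ : length Mirrored + length Free + n ≡ length N⁻ + length P⁻
      length-A⁻ = trans length-Complement (length-++ N⁻)

      Mirrored-paired : ∀ {y} → y ∈ Mirrored → negAbs y ∈ N × - negAbs y ∈ P
      Mirrored-paired {+ zero} y∈ = ⊥-elim (y∉Used (proj₂ (proj₂ (∈-Mirrored⁻ y∈))))
        where y∉Used = proj₁ (proj₂ (∈-Mirrored⁻ y∈))
      Mirrored-paired {+ suc k} y∈ =
        N⁻⊆N (negative-∈N⁻ (Used⊆A (proj₂ (proj₂ (∈-Mirrored⁻ y∈)))) -<+) ,
        P⁻⊆P (nonnegative-∈P⁻ (proj₁ (∈-Mirrored⁻ y∈)) (+≤+ z≤n))
      Mirrored-paired { -[1+ k ]} y∈ =
        N⁻⊆N (negative-∈N⁻ (proj₁ (∈-Mirrored⁻ y∈)) -<+) ,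
        P⁻⊆P (nonnegative-∈P⁻ (Used⊆A (proj₂ (proj₂ (∈-Mirrored⁻ y∈)))) (+≤+ z≤n))

      negAbs-injective : ∀ {x y} → x ∈ Mirrored → y ∈ Mirrored → negAbs x ≡ negAbs y → x ≡ y
      negAbs-injective {x} {y} x∈ y∈ eq
        with ∣i∣≡∣j∣⇒i≡±j x y (ℤP.+-injective (ℤP.neg-injective eq))
      ... | inj₁ x≡y = x≡y
      ... | inj₂ x≡-y =
        ⊥-elim (proj₁ (proj₂ (∈-Mirrored⁻ x∈)) (subst (_∈ Used) (sym x≡-y) (proj₂ (proj₂ (∈-Mirrored⁻ y∈)))))

      length-Mirrored≤ : ∀ {q} → PairedAtMost q N P → length Mirrored ≤ q
      length-Mirrored≤ (Q , |Q|≤q , covers) = ℕP.≤-trans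
        (injection⇒length≤ negAbs unique-Mirrored negAbs-injective
          (λ y∈ → covers (proj₁ (Mirrored-paired y∈)) (proj₂ (Mirrored-paired y∈))))
        |Q|≤q

      unpaired-step : length Mirrored + triangle s + n * s′ ≤ triangle s′ + suc n * s →
                      ManySums (suc n) (N ++ P) (length P) (length N⁻) s
      unpaired-step side = manySums (free ++ shifted)
        (Unique.++⁺ unique-free unique-shifted (separated⇒disjoint (μ +ᶻ β) free<μ+β μ+β≤shifted))
        (AllP.++⁺ sound-free sound-shifted)
        (ℕP.≤-trans nonempty (ℕP.≤-trans (ℕP.m≤n+m _ (length Free)) (ℕP.≤-reflexive (sym length-new))))
        (subst₂ (λ p l → suc n * p + suc n * length N⁻ + 1 + triangle s ≤ l + suc n * s + suc n * suc n)
          length-P⁻ (sym length-new) (unpaired-bound {p = length P⁻} {m = length N⁻} {t′ = triangle s′} {L = length sums}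
            {V = length Free} side split large))
        where
        length-new : length (free ++ shifted) ≡ length Free + length sums
        length-new = trans (length-++ free) (cong₂ _+_ (length-map _ Free) (length-map _ sums))
        split : length Free + length Mirrored + n ≡ length N⁻ + length P⁻
        split = trans (cong (_+ n) (ℕP.+-comm (length Free) (length Mirrored))) length-A⁻

      module Paired (-β∈N : - β ∈ N) where

        A⁻-apart--β : ∀ {z} → z ∈ A⁻ → Apart z (- β)
        A⁻-apart--β z∈ =
          proj₂ (A⁻-apart-β z∈) , λ z≡--β → proj₁ (A⁻-apart-β z∈) (trans z≡--β (ℤP.neg-involutive β))

        low : ℤ
        low = - β +ᶻ μ

        low<μ+β : low < μ +ᶻ β
        low<μ+β = subst (_< μ +ᶻ β) (ℤP.+-comm μ (- β)) (ℤP.+-monoʳ-< μ (ℤP.<-trans (ℤP.neg-mono-< 0<β) 0<β))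
          where
          0<β : + 0 < β
          0<β = ℤP.neg-cancel-< (All.lookup N<0 -β∈N)

        sound-low : InS (suc n) (N ++ P) low
        sound-low = subst (InS (suc n) (N ++ P)) (cong (- β +ᶻ_) ΣT≡μ) (admissible⇒InS
          (∷-admissible T-admissible⁺ (∈-++⁺ˡ -β∈N) (λ i → A⁻-apart--β (proj₁ T-admissible i))))

        -- The sum of T with its entry - y replaced by w, and - β adjoined.
        swapped : ℤ → ℤ → ℤ
        swapped w y = (μ +ᶻ w) +ᶻ (y -ᶻ β)

        sound-swapped : ∀ {i y w} → T i ≡ - y → w ∈ A⁻ → (∀ j → j ≢ i → Apart (T j) w) →
                        InS (suc n) (N ++ P) (swapped w y)
        sound-swapped {i} {y} {w} Ti≡-y w∈ T-apart-w = subst (InS (suc n) (N ++ P)) sum-eq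
          (admissible⇒InS (∷-admissible (admissible-⊆ A⁻⊆A T′-admissible) (∈-++⁺ˡ -β∈N)
            (λ j → A⁻-apart--β (proj₁ T′-admissible j))))
          where
          T′ : Vector ℤ n
          T′ = updateAt T i (const w)
          T′-admissible : Admissible n A⁻ T′
          T′-admissible = updateAt-admissible i T-admissible w∈ T-apart-w
          regroup : ∀ u y b → - b +ᶻ u ≡ (u +ᶻ - y) +ᶻ (y -ᶻ b)
          regroup = solve-∀
          sum-eq : - β +ᶻ sumℤ T′ ≡ swapped w y
          sum-eq = begin
            - β +ᶻ sumℤ T′               ≡⟨ regroup (sumℤ T′) y β ⟩
            (sumℤ T′ +ᶻ - y) +ᶻ (y -ᶻ β) ≡⟨ cong (λ z → (sumℤ T′ +ᶻ z) +ᶻ (y -ᶻ β)) Ti≡-y ⟨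
            (sumℤ T′ +ᶻ T i) +ᶻ (y -ᶻ β) ≡⟨ cong (_+ᶻ (y -ᶻ β)) (sumℤ-updateAt T i w) ⟩
            (sumℤ T +ᶻ w) +ᶻ (y -ᶻ β)    ≡⟨ cong (λ z → (z +ᶻ w) +ᶻ (y -ᶻ β)) ΣT≡μ ⟩
            swapped w y                  ∎
            where open ≡-Reasoning

        paired-sums : (extra : List ℤ) → Unique extra → All (InS (suc n) (N ++ P)) extra →
          (∀ {v} → v ∈ extra → v ≢ low × v < μ +ᶻ β) → length extra ≡ length Mirrored + length Free →
          ManySums (suc n) (N ++ P) (length P) (suc (length N⁻)) (suc s′)
        paired-sums extra unique-extra sound-extra below length-extra = manySums (extra ++ low ∷ shifted)
          (Unique.++⁺ unique-extra unique-rest extra∉rest)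
          (AllP.++⁺ sound-extra (sound-low ∷ sound-shifted))
          (ℕP.≤-trans (ℕP.≤-trans (s≤s z≤n) (ℕP.m≤n+m _ X)) (ℕP.≤-reflexive (sym length-new)))
          (subst₂ (λ p l → suc n * p + suc n * suc (length N⁻) + 1 + triangle (suc s′) ≤
                           l + suc n * suc s′ + suc n * suc n)
            length-P⁻ (sym length-new) (paired-bound {p = length P⁻} {m = length N⁻} length-A⁻ large))
          where
          X : ℕ
          X = length Mirrored + length Free
          unique-rest : Unique (low ∷ shifted)
          unique-rest = All.tabulate (λ v∈ low≡v → ℤP.<⇒≱ low<μ+β (subst (μ +ᶻ β ≤ᶻ_) (sym low≡v) (μ+β≤shifted v∈)))
            ∷ unique-shifted
          extra∉rest : Disjoint extra (low ∷ shifted)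
          extra∉rest (v∈extra , here v≡low) = proj₁ (below v∈extra) v≡low
          extra∉rest (v∈extra , there v∈shifted) = ℤP.<⇒≱ (proj₂ (below v∈extra)) (μ+β≤shifted v∈shifted)
          length-new : length (extra ++ low ∷ shifted) ≡ X + suc (length sums)
          length-new = trans (length-++ extra) (cong₂ _+_ length-extra (cong suc (length-map _ sums)))

        -- If Free is empty, each y ∈ Mirrored replaces its own negation in T.
        doubled : List ℤ
        doubled = map (λ y → swapped y y) Mirrored

        doubled-sums : length Free ≡ 0 → ManySums (suc n) (N ++ P) (length P) (suc (length N⁻)) (suc s′)
        doubled-sums |Free|≡0 = paired-sums doubled
          (Unique.map⁺ doubling-injective unique-Mirrored)
          (AllP.map⁺ (All.tabulate sound-doubled))
          below
          (trans (length-map _ Mirrored) (sym (trans (cong (λ k → length Mirrored + k) |Free|≡0) (ℕP.+-identityʳ _))))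
          where
          regroup : ∀ μ y b → (μ +ᶻ y) +ᶻ (y -ᶻ b) ≡ (μ -ᶻ b) +ᶻ (y +ᶻ y)
          regroup = solve-∀
          doubling-injective : ∀ {y y′} → swapped y y ≡ swapped y′ y′ → y ≡ y′
          doubling-injective {y} {y′} eq = i+i≡j+j⇒i≡j y y′
            (∙-cancelˡ (μ -ᶻ β) _ _ (trans (sym (regroup μ y β)) (trans eq (regroup μ y′ β))))
          sound-doubled : ∀ {y} → y ∈ Mirrored → InS (suc n) (N ++ P) (swapped y y)
          sound-doubled {y} y∈ with mirror-index y∈
          ... | i , Ti≡-y = sound-swapped Ti≡-y (proj₁ (∈-Mirrored⁻ y∈)) T-apart-y
            where
            T-apart-y : ∀ j → j ≢ i → Apart (T j) y
            T-apart-y j j≢i =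
              (λ Tj≡y → proj₁ (proj₂ (∈-Mirrored⁻ y∈)) (subst (_∈ Used) Tj≡y (∈-tabulate⁺ j))) ,
              (λ Tj≡-y → j≢i (admissible-injective T-admissible (trans Tj≡-y (sym Ti≡-y))))
          below : ∀ {v} → v ∈ doubled → v ≢ low × v < μ +ᶻ β
          below v∈ with ∈-map⁻ (λ y → swapped y y) v∈
          ... | y , y∈ , refl =
            (λ eq → proj₁ (proj₂ (∈-Mirrored⁻ y∈))
              (subst (_∈ Used) (sym ([μ+w]+[y-b]≡-b+μ⇒w≡-y μ y y β eq)) (proj₂ (proj₂ (∈-Mirrored⁻ y∈))))) ,
            ℤP.<-trans (y<b⇒c+[y-b]<c (μ +ᶻ y) (A⁻<β y∈A⁻)) (ℤP.+-monoʳ-< μ (A⁻<β y∈A⁻))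
            where y∈A⁻ = proj₁ (∈-Mirrored⁻ y∈)

        -- Otherwise the least w₀ ∈ Free replaces the negation of each y ∈ Mirrored in T.
        module WithFree (w₀ : ℤ) (w₀∈ : w₀ ∈ Free) (w₀≤Free : All (w₀ ≤ᶻ_) Free) where

          exchanged : List ℤ
          exchanged = map (swapped w₀) Mirrored

          exchanged<μ+w₀ : ∀ {v} → v ∈ exchanged → v < μ +ᶻ w₀
          exchanged<μ+w₀ v∈ with ∈-map⁻ (swapped w₀) v∈
          ... | y , y∈ , refl = y<b⇒c+[y-b]<c (μ +ᶻ w₀) (A⁻<β (proj₁ (∈-Mirrored⁻ y∈)))

          μ+w₀≤free : ∀ {v} → v ∈ free → μ +ᶻ w₀ ≤ᶻ v
          μ+w₀≤free v∈ with ∈-map⁻ (μ +ᶻ_) v∈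
          ... | w , w∈ , refl = ℤP.+-monoʳ-≤ μ (All.lookup w₀≤Free w∈)

          exchanged≢low : ∀ {v} → v ∈ exchanged → v ≢ low
          exchanged≢low v∈ with ∈-map⁻ (swapped w₀) v∈
          ... | y , y∈ , refl = λ eq → proj₁ (proj₂ (∈-Free⁻ w₀∈))
            (subst (_∈ Used) (sym ([μ+w]+[y-b]≡-b+μ⇒w≡-y μ w₀ y β eq)) (proj₂ (proj₂ (∈-Mirrored⁻ y∈))))

          free≢low : ∀ {v} → v ∈ free → v ≢ low
          free≢low v∈ with ∈-map⁻ (μ +ᶻ_) v∈
          ... | w , w∈ , refl = λ eq → proj₂ (A⁻-apart-β (proj₁ (∈-Free⁻ w∈)))
            (∙-cancelˡ μ w (- β) (trans eq (ℤP.+-comm (- β) μ)))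

          below : ∀ {v} → v ∈ exchanged ++ free → v ≢ low × v < μ +ᶻ β
          below {v} v∈ with ∈-++⁻ exchanged v∈
          ... | inj₁ v∈exchanged = exchanged≢low v∈exchanged ,
            ℤP.<-trans (exchanged<μ+w₀ v∈exchanged) (ℤP.+-monoʳ-< μ (A⁻<β (proj₁ (∈-Free⁻ w₀∈))))
          ... | inj₂ v∈free = free≢low v∈free , free<μ+β v∈free

          exchanged-sums : ManySums (suc n) (N ++ P) (length P) (suc (length N⁻)) (suc s′)
          exchanged-sums = paired-sums (exchanged ++ free)
            (Unique.++⁺ (Unique.map⁺ (λ {y} {y′} eq → ∙-cancelʳ (- β) y y′ (∙-cancelˡ (μ +ᶻ w₀) _ _ eq)) unique-Mirrored)
              unique-free (separated⇒disjoint (μ +ᶻ w₀) exchanged<μ+w₀ μ+w₀≤free))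
            (AllP.++⁺ (AllP.map⁺ (All.tabulate sound-exchanged)) sound-free)
            below
            (trans (length-++ exchanged) (cong₂ _+_ (length-map _ Mirrored) (length-map _ Free)))
            where
            sound-exchanged : ∀ {y} → y ∈ Mirrored → InS (suc n) (N ++ P) (swapped w₀ y)
            sound-exchanged y∈ with mirror-index y∈
            ... | i , Ti≡-y = sound-swapped Ti≡-y (proj₁ (∈-Free⁻ w₀∈)) (λ j _ → Free-apart w₀∈ j)

        paired-step : ManySums (suc n) (N ++ P) (length P) (suc (length N⁻)) (suc s′)
        paired-step with length Free in |Free|≡
        ... | zero = doubled-sums |Free|≡
        ... | suc _ with least Free (subst (1 ≤_) (sym |Free|≡) (s≤s z≤n))
        ...   | w₀ , w₀∈ , w₀≤Free = WithFree.exchanged-sums w₀ w₀∈ w₀≤Free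

  unpaired : - β ∉ N → Induction-hypothesis → ManySums (suc n) (N ++ P) (length P) (length N) s
  unpaired -β∉N ih = by-cases few-pairs
    where
    open Below N unique-N id (λ z∈N z≡-β → -β∉N (subst (_∈ N) z≡-β z∈N))
    config : ∀ {s′} → s′ ≤ n → s′ ≡ n ⊎ PairedAtMost s′ N P⁻ → Config n N P⁻ s′
    config s′≤n pairs = record
      { unique-N = unique-N ; N<0 = N<0 ; unique-P = Unique.filter⁺ _ unique-P ; 0≤P = 0≤P⁻
      ; n≤|P| = n≤|P⁻| ; cap≤n = s′≤n ; few-pairs = pairs }
    saturated : s ≡ suc n → ManySums (suc n) (N ++ P) (length P) (length N) s
    saturated refl = E.unpaired-step (saturated-side E.length-Mirrored≤n)
      where module E = Extend (ih (config ℕP.≤-refl (inj₁ refl)))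
    by-cases : s ≡ suc n ⊎ PairedAtMost s N P → ManySums (suc n) (N ++ P) (length P) (length N) s
    by-cases (inj₁ s≡1+n) = saturated s≡1+n
    by-cases (inj₂ (Q , |Q|≤s , covers)) with s ℕP.≤? n
    ... | yes s≤n = E.unpaired-step (unsaturated-side {n = n} (E.length-Mirrored≤ (Q , |Q|≤s , covers)))
      where module E = Extend (ih (config s≤n (inj₂ (Q , |Q|≤s , λ z∈ -z∈ → covers z∈ (P⁻⊆P -z∈)))))
    ... | no s≰n = saturated (ℕP.≤-antisym cap≤n (ℕP.≰⇒> s≰n))

  N⁻ : List ℤ
  N⁻ = remove (- β) N

  ∈-N⁻⁻ : ∀ {z} → z ∈ N⁻ → z ∈ N × z ≢ - β
  ∈-N⁻⁻ = ∈-remove⁻ {ys = N}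

  lower-cap : - β ∈ N → s ≡ suc n ⊎ PairedAtMost s N P →
              ∃ λ s′ → s ≡ suc s′ × (s′ ≡ n ⊎ PairedAtMost s′ N⁻ P⁻)
  lower-cap _ (inj₁ s≡1+n) = n , s≡1+n , inj₁ refl
  lower-cap -β∈N (inj₂ (Q , |Q|≤s , covers)) =
    pred s , sym (ℕP.suc-pred s {{≢-nonZero s≢0}}) , inj₂ (remove (- β) Q , ℕP.pred-mono-≤ |Q⁻|<s , covers⁻)
    where
    -β∈Q : - β ∈ Q
    -β∈Q = covers -β∈N (subst (_∈ P) (sym (ℤP.neg-involutive β)) β∈P)
    |Q⁻|<s : suc (length (remove (- β) Q)) ≤ s
    |Q⁻|<s = ℕP.≤-trans (length-remove< -β∈Q) |Q|≤s
    s≢0 : s ≢ 0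
    s≢0 refl with |Q⁻|<s
    ... | ()
    covers⁻ : ∀ {z} → z ∈ N⁻ → - z ∈ P⁻ → z ∈ remove (- β) Q
    covers⁻ z∈ -z∈ = ∈-remove⁺ (covers (proj₁ (∈-N⁻⁻ z∈)) (P⁻⊆P -z∈)) (proj₂ (∈-N⁻⁻ z∈))

  paired : - β ∈ N → Induction-hypothesis → ManySums (suc n) (N ++ P) (length P) (length N) s
  paired -β∈N ih with lower-cap -β∈N few-pairs
  ... | s′ , refl , pairs = subst (λ m → ManySums (suc n) (N ++ P) (length P) m (suc s′))
          (length-remove unique-N -β∈N) (E.Paired.paired-step -β∈N)
    where
    open Below N⁻ (Unique.filter⁺ _ unique-N) (proj₁ ∘ ∈-N⁻⁻) (proj₂ ∘ ∈-N⁻⁻)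
    config : Config n N⁻ P⁻ s′
    config = record
      { unique-N = Unique.filter⁺ _ unique-N ; N<0 = AllP.anti-mono (proj₁ ∘ ∈-N⁻⁻) N<0
      ; unique-P = Unique.filter⁺ _ unique-P ; 0≤P = 0≤P⁻ ; n≤|P| = n≤|P⁻|
      ; cap≤n = ℕP.≤-pred cap≤n ; few-pairs = pairs }
    module E = Extend (ih config)

sumset-bound : ∀ n {N P s} → Config n N P s → ManySums n (N ++ P) (length P) (length N) s
sumset-bound zero c = base c
sumset-bound (suc n) {N} c with - Step.β c ∈? N
... | yes -β∈N = Step.paired c -β∈N (sumset-bound n)
... | no -β∉N = Step.unpaired c -β∉N (sumset-bound n)

triangle-double : ∀ x → 2 * triangle x ≡ x * suc x
triangle-double zero = refl
triangle-double (suc x) = begin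
  2 * (suc x + triangle x)   ≡⟨ ℕP.*-distribˡ-+ 2 (suc x) (triangle x) ⟩
  2 * suc x + 2 * triangle x ≡⟨ cong (λ z → 2 * suc x + z) (triangle-double x) ⟩
  2 * suc x + x * suc x      ≡⟨ regroup x ⟩
  suc x * suc (suc x)        ∎
  where
  open ≡-Reasoning
  open +-*-Solver
  regroup : ∀ x → 2 * suc x + x * suc x ≡ suc x * suc (suc x)
  regroup = solve 1 (λ x → con 2 :* (con 1 :+ x) :+ x :* (con 1 :+ x) := (con 1 :+ x) :* (con 2 :+ x)) refl

suc-C-2 : ∀ j → suc j C 2 ≡ triangle j
suc-C-2 zero = refl
suc-C-2 (suc j) = trans (sym (nCk+nC[k+1]≡[n+1]C[k+1] (suc j) 1)) (cong₂ _+_ (nC1≡n (suc j)) (suc-C-2 j))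

triangle-gap : ∀ m r → let n = 2 + m + r in
  m * n + n * n + 1 + r + triangle r ≡ 3 * triangle (suc (m + r)) + n + triangle m
triangle-gap m r = ℕP.*-cancelˡ-≡ _ _ 2 (begin
  2 * (X + triangle r)                          ≡⟨ ℕP.*-distribˡ-+ 2 X (triangle r) ⟩
  2 * X + 2 * triangle r                        ≡⟨ cong (λ z → 2 * X + z) (triangle-double r) ⟩
  2 * X + r * suc r                             ≡⟨ polynomial m r ⟩
  3 * (k * suc k) + 2 * n + m * suc m           ≡⟨ cong₂ (λ a b → 3 * a + 2 * n + b)
                                                         (triangle-double k) (triangle-double m) ⟨
  3 * (2 * triangle k) + 2 * n + 2 * triangle m ≡⟨ collect (triangle k) n (triangle m) ⟩
  2 * (3 * triangle k + n + triangle m)         ∎)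
  where
  open ≡-Reasoning
  open +-*-Solver
  n k X : ℕ
  n = 2 + m + r
  k = suc (m + r)
  X = m * n + n * n + 1 + r
  polynomial : ∀ m r → 2 * (m * (2 + m + r) + (2 + m + r) * (2 + m + r) + 1 + r) + r * suc r ≡
               3 * (suc (m + r) * suc (suc (m + r))) + 2 * (2 + m + r) + m * suc m
  polynomial = solve 2 (λ m r →
    con 2 :* (m :* (con 2 :+ m :+ r) :+ (con 2 :+ m :+ r) :* (con 2 :+ m :+ r) :+ con 1 :+ r) :+ r :* (con 1 :+ r) :=
    con 3 :* ((con 1 :+ m :+ r) :* (con 2 :+ m :+ r)) :+ con 2 :* (con 2 :+ m :+ r) :+ m :* (con 1 :+ m)) refl
  collect : ∀ a n b → 3 * (2 * a) + 2 * n + 2 * b ≡ 2 * (3 * a + n + b)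
  collect = solve 3 (λ a n b → con 3 :* (con 2 :* a) :+ con 2 :* n :+ con 2 :* b := con 2 :* (con 3 :* a :+ n :+ b)) refl

∸-+-≤ : ∀ {a b c L} → a + c ≤ b + L → c ≤ L → a ∸ b + c ≤ L
∸-+-≤ {a} {b} {c} {L} a+c≤b+L c≤L = ℕP.m≤o∸n⇒m+n≤o (a ∸ b) c≤L
  (ℕP.m≤n+o⇒m∸n≤o a b (subst (a ≤_) (ℕP.+-∸-assoc b c≤L) (ℕP.m+n≤o⇒m≤o∸n a a+c≤b+L)))

exceeds-critical-size : ∀ m r p {L} → let n = 2 + m + r in suc n ≤ p →
  n * p + n * m + 1 + triangle m ≤ L + n * m + n * n →
  (m + p ∸ 1) * n ∸ 3 * (n C 2) + 1 <ℕ L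
exceeds-critical-size m r (suc p) {L} n<p large =
  subst (_≤ L) (ℕP.+-suc _ 1) (∸-+-≤ {b = 3 * (n C 2)} key 2≤L)
  where
  open ℕP.≤-Reasoning
  open +-*-Solver
  n k : ℕ
  n = 2 + m + r
  k = suc (m + r)
  bound : n * suc p + 1 + triangle m ≤ L + n * n
  bound = ℕP.+-cancelʳ-≤ (n * m) _ _ (subst₂ _≤_ (regroupˡ n (suc p) m (triangle m)) (regroupʳ n m L) large)
    where
    regroupˡ : ∀ n p m t → n * p + n * m + 1 + t ≡ n * p + 1 + t + n * m
    regroupˡ = solve 4 (λ n p m t → n :* p :+ n :* m :+ con 1 :+ t := n :* p :+ con 1 :+ t :+ n :* m) refl
    regroupʳ : ∀ n m L → L + n * m + n * n ≡ L + n * n + n * m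
    regroupʳ = solve 3 (λ n m L → L :+ n :* m :+ n :* n := L :+ n :* n :+ n :* m) refl
  gap : m * n + n * n + 1 ≤ 3 * triangle k + n + triangle m
  gap = ℕP.≤-trans (ℕP.≤-trans (ℕP.m≤m+n _ r) (ℕP.m≤m+n _ (triangle r))) (ℕP.≤-reflexive (triangle-gap m r))
  key : (m + suc p ∸ 1) * n + 2 ≤ 3 * (n C 2) + L
  key = ℕP.+-cancelʳ-≤ (n * n) _ _ (begin
    (m + suc p ∸ 1) * n + 2 + n * n               ≡⟨ cong (λ z → (z ∸ 1) * n + 2 + n * n) (ℕP.+-suc m p) ⟩
    (m + p) * n + 2 + n * n                       ≡⟨ split m p n ⟩
    (m * n + n * n + 1) + (p * n + 1)             ≤⟨ ℕP.+-monoˡ-≤ (p * n + 1) gap ⟩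
    (3 * triangle k + n + triangle m) + (p * n + 1) ≡⟨ merge (triangle k) n (triangle m) p ⟩
    3 * triangle k + (n * suc p + 1 + triangle m) ≤⟨ ℕP.+-monoʳ-≤ (3 * triangle k) bound ⟩
    3 * triangle k + (L + n * n)                  ≡⟨ cong (λ z → 3 * z + (L + n * n)) (suc-C-2 k) ⟨
    3 * (n C 2) + (L + n * n)                     ≡⟨ ℕP.+-assoc (3 * (n C 2)) L (n * n) ⟨
    3 * (n C 2) + L + n * n                       ∎)
    where
    split : ∀ m p n → (m + p) * n + 2 + n * n ≡ (m * n + n * n + 1) + (p * n + 1)
    split = solve 3 (λ m p n → (m :+ p) :* n :+ con 2 :+ n :* n := (m :* n :+ n :* n :+ con 1) :+ (p :* n :+ con 1)) refl
    merge : ∀ a n b p → (3 * a + n + b) + (p * n + 1) ≡ 3 * a + (n * suc p + 1 + b)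
    merge = solve 4 (λ a n b p → (con 3 :* a :+ n :+ b) :+ (p :* n :+ con 1) := con 3 :* a :+ (n :* (con 1 :+ p) :+ con 1 :+ b)) refl
  2≤L : 2 ≤ L
  2≤L = ℕP.+-cancelʳ-≤ (n * n) 2 L (begin
    2 + n * n                  ≤⟨ ℕP.+-monoˡ-≤ (n * n) (s≤s (s≤s z≤n)) ⟩
    n + n * n                  ≡⟨ ℕP.*-suc n n ⟨
    n * suc n                  ≤⟨ ℕP.*-monoʳ-≤ n n<p ⟩
    n * suc p                  ≤⟨ ℕP.≤-trans (ℕP.m≤m+n _ 1) (ℕP.m≤m+n _ (triangle m)) ⟩
    n * suc p + 1 + triangle m ≤⟨ bound ⟩
    L + n * n                  ∎)

p-large : ∀ m r p → 2 * (2 + m + r) ∸ 1 ≤ m + p → suc (2 + m + r) ≤ p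
p-large m r p 2n∸1≤m+p =
  ℕP.≤-trans (ℕP.m≤m+n _ r) (ℕP.+-cancelˡ-≤ m _ _ (ℕP.≤-trans (ℕP.≤-reflexive (regroup m r)) 2n∸1≤m+p))
  where
  open +-*-Solver
  regroup : ∀ m r → m + (suc (2 + m + r) + r) ≡ suc (m + r) + (suc (suc (m + r)) + 0)
  regroup = solve 2 (λ m r → m :+ ((con 3 :+ m :+ r) :+ r) := (con 1 :+ m :+ r) :+ ((con 2 :+ m :+ r) :+ con 0)) refl

enough-negatives : ∀ n k → 2 * n ∸ 1 ≤ k → (A : List ℤ) → Unique A → length A ≡ k → (L : List ℤ) →
  (∀ {x} → InS n A x → x ∈ L) → length L ≡ (k ∸ 1) * n ∸ 3 * (n C 2) + 1 →
  n ∸ 1 ≤ length (filter (λ x → x <? + 0) A)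
enough-negatives zero _ _ _ _ _ _ _ _ = z≤n
enough-negatives (suc n) k 2n∸1≤k A unique-A |A|≡k L S⊆L |L|≡
  with n ℕP.≤? length (filter (λ x → x <? + 0) A)
... | yes enough = enough
... | no few with ℕP.m≤n⇒∃[o]m+o≡n (ℕP.≰⇒> few)
...   | r , refl = ⊥-elim (ℕP.<⇒≱ too-many (ℕP.≤-trans (Unique-⊆⇒length≤ unique sums⊆L) (ℕP.≤-reflexive |L|≡)))
  where
  N P : List ℤ
  N = filter (λ x → x <? + 0) A
  P = filter (λ x → ¬? (x <? + 0)) A
  m : ℕ
  m = length N
  m+p≡k : m + length P ≡ k
  m+p≡k = trans (length-filter-split (λ x → x <? + 0) A) |A|≡k
  n<p : suc (2 + m + r) ≤ length P
  n<p = p-large m r (length P) (subst (2 * (2 + m + r) ∸ 1 ≤_) (sym m+p≡k) 2n∸1≤k)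
  config : Config (2 + m + r) N P m
  config = record
    { unique-N = Unique.filter⁺ _ unique-A
    ; N<0 = All.tabulate (proj₂ ∘ ∈-filter⁻ (λ x → x <? + 0) {xs = A})
    ; unique-P = Unique.filter⁺ _ unique-A
    ; 0≤P = All.tabulate (ℤP.≮⇒≥ ∘ proj₂ ∘ ∈-filter⁻ (λ x → ¬? (x <? + 0)) {xs = A})
    ; n≤|P| = ℕP.≤-trans (ℕP.n≤1+n _) n<p
    ; cap≤n = ℕP.≤-trans (ℕP.m≤n+m m 2) (ℕP.m≤m+n (2 + m) r)
    ; few-pairs = inj₂ (N , ℕP.≤-refl , λ z∈N _ → z∈N) }
  open ManySums (sumset-bound _ config)
  sums⊆L : sums ⊆ L
  sums⊆L v∈ = S⊆L (InS-⊆ N++P⊆A (All.lookup sound v∈))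
    where
    N++P⊆A : N ++ P ⊆ A
    N++P⊆A z∈ = [ ⊆.filter-⊆ _ A , ⊆.filter-⊆ _ A ] (∈-++⁻ N z∈)
  too-many : (k ∸ 1) * (2 + m + r) ∸ 3 * ((2 + m + r) C 2) + 1 <ℕ length sums
  too-many = subst (λ k → (k ∸ 1) * (2 + m + r) ∸ 3 * ((2 + m + r) C 2) + 1 <ℕ length sums) m+p≡k
    (exceeds-critical-size m r (length P) n<p large)

neg-sumℤ : ∀ {n} (a : Vector ℤ n) → sumℤ (λ i → - a i) ≡ - sumℤ a
neg-sumℤ {zero} a = refl
neg-sumℤ {suc n} a = trans (cong (- a zero +ᶻ_) (neg-sumℤ (Vec.tail a))) (sym (ℤP.neg-distrib-+ (a zero) _))

InS-neg : ∀ {n A x} → InS n (map -_ A) x → InS n A (- x)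
InS-neg {n} {A} (a , mem , dist , refl) = (λ i → - a i) , mem′ , dist′ , neg-sumℤ a
  where
  mem′ : ∀ i → - a i ∈ A
  mem′ i with ∈-map⁻ -_ (mem i)
  ... | y , y∈A , ai≡-y = subst (_∈ A) (trans (sym (ℤP.neg-involutive y)) (cong -_ (sym ai≡-y))) y∈A
  dist′ : ∀ i j → i ≢ j → - a i *ᶻ - a i ≢ - a j *ᶻ - a j
  dist′ i j i≢j rewrite neg-square (a i) | neg-square (a j) = dist i j i≢j

length-filter-neg : ∀ A → length (filter (λ x → x <? + 0) (map -_ A)) ≡ length (filter (λ x → + 0 <? x) A)
length-filter-neg [] = refl
length-filter-neg (x ∷ A) with - x <? + 0 | + 0 <? x
... | yes _ | yes _ = cong suc (length-filter-neg A)
... | no _ | no _ = length-filter-neg A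
... | yes -x<0 | no 0≮x = ⊥-elim (0≮x (ℤP.neg-cancel-< -x<0))
... | no -x≮0 | yes 0<x = ⊥-elim (-x≮0 (ℤP.neg-mono-< 0<x))

lemma3p1 : (n k : ℕ) → n > 2 → 2 * n ∸ 1 ≤ k →
    (A : List ℤ) → Unique A → length A ≡ k →
    (L : List ℤ) → Unique L → (∀ x → (x ∈ L) ⇔ InS n A x) →
    length L ≡ (k ∸ 1) * n ∸ 3 * (n C 2) + 1 →
    (n ∸ 1 ≤ length (filter (λ x → x <? + 0) A)) ×
    (n ∸ 1 ≤ length (filter (λ x → + 0 <? x) A))
lemma3p1 n k _ 2n∸1≤k A unique-A |A|≡k L _ L⇔S |L|≡ =
  enough-negatives n k 2n∸1≤k A unique-A |A|≡k L (Equivalence.from (L⇔S _)) |L|≡ ,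
  subst (n ∸ 1 ≤_) (length-filter-neg A)
    (enough-negatives n k 2n∸1≤k (map -_ A) (Unique.map⁺ ℤP.neg-injective unique-A)
      (trans (length-map -_ A) |A|≡k) (map -_ L) -S⊆-L (trans (length-map -_ L) |L|≡))
  where
  -S⊆-L : ∀ {x} → InS n (map -_ A) x → x ∈ map -_ L
  -S⊆-L {x} x∈ =
    subst (_∈ map -_ L) (ℤP.neg-involutive x) (∈-map⁺ -_ (Equivalence.from (L⇔S (- x)) (InS-neg x∈)))
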